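{- For every integer $k \geq 1$, there exists a $k$-uniform hypergraph $\mathcal{H}$ with $|E(\mathcal{H})| = \left\lfloor \frac{k}{2}\right\rfloor + 1$ such that Maker wins the $(k,1)$-game on $\mathcal{H}$.
   Context: A hypergraph $\mathcal{H}$ consists of a finite vertex set $V(\mathcal{H})$ and a set $E(\mathcal{H})$ of subsets of $V(\mathcal{H})$ (edges); it is $k$-uniform if every edge has exactly $k$ vertices. The $(a,b)$-game on $\mathcal{H}$: Maker has $a$ tokens and Breaker has $b$ tokens; initially the board is empty. Players alternate turns, Maker first. On a turn a player may pass, or place one of their own tokens on an unoccupied vertex, the token being either not yet used or moved from its current vertex on the board (which becomes unoccupied). Maker wins as soon as all vertices of some edge carry Maker tokens; Breaker wins if this never happens or if the game reaches the same state twice. "Maker wins" means Maker has a winning strategy. -}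

module Defs where

open import Data.Nat using (ℕ; zero; suc; _<_)
open import Data.Bool using (Bool; true; false)
open import Data.Fin using (Fin)
open import Data.Fin.Subset using (Subset; ∣_∣)
open import Data.Vec using (Vec; []; _∷_; lookup; replicate; _[_]≔_)
open import Data.List using (List; []; _∷_; [_])
open import Data.List.Relation.Unary.All using (All)
open import Data.List.Relation.Unary.Any using (Any)
open import Data.List.Relation.Unary.Unique.Propositional using (Unique)
open import Data.List.Membership.Propositional using (_∈_; _∉_)
open import Data.Product using (Σ; _×_; _,_)
open import Relation.Binary.PropositionalEquality using (_≡_)

record Hypergraph (n : ℕ) : Set where
  field
    edges    : List (Subset n)
    distinct : Unique edges
open Hypergraph public

Uniform : ∀ {n} → ℕ → Hypergraph n → Set
Uniform k H = All (λ e → ∣ e ∣ ≡ k) (edges H)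

numEdges : ∀ {n} → Hypergraph n → ℕ
numEdges H = Data.List.length (edges H)

data Player : Set where
  maker breaker : Player

data Cell : Set where
  empty : Cell
  tok   : Player → Cell

Board : ℕ → Set
Board n = Vec Cell n

emptyBoard : ∀ {n} → Board n
emptyBoard = replicate _ empty

sameP : Player → Player → Bool
sameP maker   maker   = true
sameP breaker breaker = true
sameP _       _       = false

isTok : Player → Cell → Bool
isTok p empty   = false
isTok p (tok q) = sameP p q

onBoard : ∀ {n} → Player → Board n → ℕ
onBoard p []       = 0
onBoard p (c ∷ cs) with isTok p c
... | true  = suc (onBoard p cs)
... | false = onBoard p cs

-- A legal turn of player p (who owns `lim` tokens) from board b to b'
data Move {n : ℕ} (p : Player) (lim : ℕ) (b : Board n) : Board n → Set where
  pass  : Move p lim b b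
  place : (v : Fin n) → onBoard p b < lim → lookup b v ≡ empty →
          Move p lim b (b [ v ]≔ tok p)
  shift : (u v : Fin n) → lookup b u ≡ tok p → lookup b v ≡ empty →
          Move p lim b ((b [ u ]≔ empty) [ v ]≔ tok p)

Completed : ∀ {n} → Hypergraph n → Board n → Set
Completed {n} H b = Any (λ e → (v : Fin n) → lookup e v ≡ true → lookup b v ≡ tok maker) (edges H)

-- A game state = (player to move, board).  The history lists all states
-- reached so far (including the current one).
State : ℕ → Set
State n = Player × Board n

data MakerWinsFrom {n : ℕ} (H : Hypergraph n) (a b : ℕ)
     : List (State n) → Board n → Set where
  win  : ∀ {hist s s'} → Move maker a s s' → Completed H s' →
         MakerWinsFrom H a b hist s
  step : ∀ {hist s s'} → Move maker a s s' →
         (breaker , s') ∉ hist →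
         (∀ {s''} → Move breaker b s' s'' →
            ((maker , s'') ∉ ((breaker , s') ∷ hist)) ×
            MakerWinsFrom H a b ((maker , s'') ∷ (breaker , s') ∷ hist) s'') →
         MakerWinsFrom H a b hist s

MakerWins : ∀ {n} → Hypergraph n → ℕ → ℕ → Set
MakerWins H a b = MakerWinsFrom H a b [ (maker , emptyBoard) ] emptyBoard

{-# OPTIONS --safe #-}
module Submission where

-- Write k = r + 2t with r ≤ 1 and take the k + 2 vertices 0, …, k + 1: the first r of them lie in every
-- edge, the remaining ones form the t + 1 pairs {r + 2j, r + 2j + 1}, and the edges are the complements
-- of these pairs. Maker takes vertex 0 and then fills the vertices in increasing order, skipping the one
-- vertex ("the hole") that Breaker's single token blocks; so after p moves she owns {0, …, p} except a
-- hole h ≥ 1. After k moves: if h = k she owns the complement of the last pair {k, k + 1}; if h < k is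
-- free she moves her token from k to h and owns the same edge; if Breaker sits on h, vertex k + 1 is free
-- and she moves her token from the partner of h to k + 1, owning the complement of h's pair. Her token
-- count increases every round, so no state is ever repeated.

open import Defs
open import Data.Nat using (ℕ; _≤_; _+_)
open import Data.Nat.DivMod using (_/_)
open import Data.Product using (Σ; _×_)
open import Relation.Binary.PropositionalEquality using (_≡_)

open import Data.Nat using (zero; suc; _<_; _*_; _∸_; z≤n; s≤s)
open import Data.Nat.Properties
  using (≤-refl; ≤-reflexive; ≤-trans; ≤-pred; n≤1+n; n<1+n; 1+n≢n; m≤n⇒m≤1+n; m<n⇒m<1+n; m≤n+m;
         1+n≰n; <⇒≤; <⇒≢; <⇒≱; ≤∧≢⇒<; m≤n⇒m<n∨m≡n; n≤0⇒n≡0; +-suc; +-comm; +-monoʳ-≤; *-monoˡ-≤;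
         +-cancelˡ-≡; +-cancelˡ-<;
         *-cancelʳ-≡; m+[n∸m]≡n; m∸n+n≡m; module ≤-Reasoning)
  renaming (_≟_ to _≟ℕ_)
open import Data.Nat.DivMod using (_%_; m≡m%n+[m/n]*n; m%n<n)
open import Data.Bool using (true; false)
open import Data.Fin using (Fin; zero; suc; toℕ; fromℕ; fromℕ<; inject₁)
open import Data.Fin.Properties using (_≟_; toℕ-injective; toℕ-fromℕ; toℕ-fromℕ<; toℕ-inject₁; toℕ<n)
open import Data.Fin.Subset using (Subset; ∣_∣; ⁅_⁆; _∪_; ∁; _∈_)
open import Data.Fin.Subset.Properties
  using (∣⁅x⁆∣≡1; ∣∁p∣≡n∸∣p∣; ∪-identityˡ; x∈⁅x⁆; x∈⁅y⁆⇒x≡y; x∈p∪q⁺; x∈p∪q⁻;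
         x∈∁p⇒x∉p; x∈p⇒x∉∁p; x∉∁p⇒x∈p)
open import Data.Vec using (Vec; []; _∷_; lookup; _[_]≔_)
open import Data.Vec.Properties using (lookup∘update; lookup∘update′; lookup-replicate; lookup⇒[]=)
open import Data.List using (List; []; _∷_; tabulate)
open import Data.List.Properties using (length-tabulate)
open import Data.List.Relation.Unary.All as All using (All; _∷_; [])
open import Data.List.Relation.Unary.All.Properties as All using ()
open import Data.List.Relation.Unary.Any as Any using (Any; here; there)
open import Data.List.Relation.Unary.Any.Properties as Any using ()
open import Data.List.Relation.Unary.Unique.Propositional.Properties as Unique using ()
open import Data.List.Membership.Propositional using (_∉_)
open import Data.Product using (_,_; proj₁; proj₂; ∃-syntax; swap)
open import Data.Sum as Sum using (_⊎_; inj₁; inj₂)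
open import Data.Empty using (⊥; ⊥-elim)
open import Function using (_∘_)
open import Function.Bundles using (_⇔_; mk⇔; Equivalence)
open import Function.Properties.Equivalence using () renaming (trans to ⇔-trans)
open import Relation.Nullary using (yes; no)
open import Relation.Binary.PropositionalEquality using (_≢_; refl; sym; trans; cong; subst; subst₂; module ≡-Reasoning)

open Equivalence using (to; from)

private
  variable
    n : ℕ
    A : Set

lookup-update⁻ : ∀ (xs : Vec A n) i j {x y} → lookup (xs [ i ]≔ x) j ≡ y → j ≡ i ⊎ lookup xs j ≡ y
lookup-update⁻ xs i j eq with j ≟ i
... | yes j≡i = inj₁ j≡i
... | no  j≢i = inj₂ (trans (sym (lookup∘update′ j≢i xs _)) eq)

lookup-update-≢ : ∀ (xs : Vec A n) i j {x y} → y ≢ x → lookup (xs [ i ]≔ x) j ≡ y → lookup xs j ≡ y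
lookup-update-≢ xs i j y≢x eq with j ≟ i
... | yes refl = ⊥-elim (y≢x (trans (sym eq) (lookup∘update j xs _)))
... | no  j≢i  = trans (sym (lookup∘update′ j≢i xs _)) eq

lookup-update⁺ : ∀ (xs : Vec A n) i j {x} → (j ≢ i → lookup xs j ≡ x) → lookup (xs [ i ]≔ x) j ≡ x
lookup-update⁺ xs i j kept with j ≟ i
... | yes refl = lookup∘update j xs _
... | no  j≢i  = trans (lookup∘update′ j≢i xs _) (kept j≢i)

lookup-update₂⁺ : ∀ (xs : Vec A n) i i′ j {x y} →
                  (j ≢ i′ → j ≢ i × lookup xs j ≡ x) → lookup ((xs [ i ]≔ y) [ i′ ]≔ x) j ≡ x
lookup-update₂⁺ xs i i′ j {y = y} kept = lookup-update⁺ (xs [ i ]≔ y) i′ j λ j≢i′ →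
  let j≢i , eq = kept j≢i′ in trans (lookup∘update′ j≢i xs _) eq

isTok-tok : ∀ p → isTok p (tok p) ≡ true
isTok-tok maker   = refl
isTok-tok breaker = refl

isTok-other : ∀ {p q} → q ≢ p → isTok q (tok p) ≡ false
isTok-other {maker}   {maker}   q≢p = ⊥-elim (q≢p refl)
isTok-other {maker}   {breaker} _   = refl
isTok-other {breaker} {maker}   _   = refl
isTok-other {breaker} {breaker} q≢p = ⊥-elim (q≢p refl)

isTok⇔≡tok : ∀ p c → isTok p c ≡ true ⇔ c ≡ tok p
isTok⇔≡tok p c = mk⇔ (isTok⇒≡tok p c) λ { refl → isTok-tok p }
  where
  isTok⇒≡tok : ∀ p c → isTok p c ≡ true → c ≡ tok p
  isTok⇒≡tok maker   (tok maker)   _ = refl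
  isTok⇒≡tok breaker (tok breaker) _ = refl
  isTok⇒≡tok _       empty         ()
  isTok⇒≡tok maker   (tok breaker) ()
  isTok⇒≡tok breaker (tok maker)   ()

cell-empty : ∀ c → c ≢ tok maker → c ≢ tok breaker → c ≡ empty
cell-empty empty         _  _  = refl
cell-empty (tok maker)   ¬m _  = ⊥-elim (¬m refl)
cell-empty (tok breaker) _  ¬b = ⊥-elim (¬b refl)

SameTokens : Player → Board n → Board n → Set
SameTokens p b b′ = ∀ v → isTok p (lookup b v) ≡ isTok p (lookup b′ v)

sameTokens-owner : ∀ {p} {b b′ : Board n} → SameTokens p b b′ → ∀ v → lookup b v ≡ tok p ⇔ lookup b′ v ≡ tok p
sameTokens-owner {p = p} same v = mk⇔
  (to (isTok⇔≡tok p _) ∘ trans (sym (same v)) ∘ from (isTok⇔≡tok p _))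
  (to (isTok⇔≡tok p _) ∘ trans (same v) ∘ from (isTok⇔≡tok p _))

onBoard-cong : ∀ p {b b′ : Board n} → SameTokens p b b′ → onBoard p b ≡ onBoard p b′
onBoard-cong p {[]}     {[]}     same = refl
onBoard-cong p {c ∷ cs} {d ∷ ds} same with isTok p c | isTok p d | same zero
... | true  | true  | refl = cong suc (onBoard-cong p {cs} {ds} (same ∘ suc))
... | false | false | refl = onBoard-cong p {cs} {ds} (same ∘ suc)

sameTokens-update : ∀ p (b : Board n) i {x} → isTok p x ≡ isTok p (lookup b i) → SameTokens p (b [ i ]≔ x) b
sameTokens-update p b i same v with v ≟ i
... | yes refl = trans (cong (isTok p) (lookup∘update v b _)) same
... | no  v≢i  = cong (isTok p) (lookup∘update′ v≢i b _)

move-sameTokens : ∀ {p q l} {b b′ : Board n} → q ≢ p → Move p l b b′ → SameTokens q b′ b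
move-sameTokens q≢p pass _ = refl
move-sameTokens {q = q} {b = b} q≢p (place i _ free) =
  sameTokens-update q b i (trans (isTok-other q≢p) (sym (cong (isTok q) free)))
move-sameTokens {q = q} {b = b} q≢p (shift u i own free) v = trans (placed v) (vacated v)
  where
  vacated : SameTokens q (b [ u ]≔ empty) b
  vacated = sameTokens-update q b u (sym (trans (cong (isTok q) own) (isTok-other q≢p)))
  placed : SameTokens q ((b [ u ]≔ empty) [ i ]≔ tok _) (b [ u ]≔ empty)
  placed = sameTokens-update q (b [ u ]≔ empty) i
             (trans (isTok-other q≢p) (sym (cong (isTok q) (lookup-update⁺ b u i λ _ → free))))

onBoard-place : ∀ p (b : Board n) i → lookup b i ≡ empty → onBoard p (b [ i ]≔ tok p) ≡ suc (onBoard p b)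
onBoard-place maker   (_ ∷ _)  zero    refl = refl
onBoard-place breaker (_ ∷ _)  zero    refl = refl
onBoard-place p       (c ∷ cs) (suc i) free with isTok p c
... | true  = cong suc (onBoard-place p cs i free)
... | false = onBoard-place p cs i free

tok⇒0<onBoard : ∀ p (b : Board n) i → lookup b i ≡ tok p → 0 < onBoard p b
tok⇒0<onBoard maker   (_ ∷ _)  zero    refl = s≤s z≤n
tok⇒0<onBoard breaker (_ ∷ _)  zero    refl = s≤s z≤n
tok⇒0<onBoard p       (c ∷ cs) (suc i) own with isTok p c
... | true  = s≤s z≤n
... | false = tok⇒0<onBoard p cs i own

onBoard-emptyBoard : ∀ p → onBoard p (emptyBoard {n}) ≡ 0
onBoard-emptyBoard {zero}  p = refl
onBoard-emptyBoard {suc n} p = onBoard-emptyBoard {n} p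

AtMostOne : Player → Board n → Set
AtMostOne {n} p b = ∀ (u v : Fin n) → lookup b u ≡ tok p → lookup b v ≡ tok p → u ≡ v

atMostOne-emptyBoard : ∀ p → AtMostOne p (emptyBoard {n})
atMostOne-emptyBoard p u _ own _ with trans (sym own) (lookup-replicate u empty)
... | ()

atMostOne-update : ∀ {p} (b : Board n) i {x} → tok p ≢ x → AtMostOne p b → AtMostOne p (b [ i ]≔ x)
atMostOne-update b i ne one u v own₁ own₂ =
  one u v (lookup-update-≢ b i u ne own₁) (lookup-update-≢ b i v ne own₂)

atMostOne-at : ∀ {p} (b : Board n) i → (∀ w → lookup b w ≡ tok p → w ≡ i) → AtMostOne p b
atMostOne-at _ i at u v own₁ own₂ = trans (at u own₁) (sym (at v own₂))

atMostOne-move : ∀ {p} {b b′ : Board n} → Move p 1 b b′ → AtMostOne p b → AtMostOne p b′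
atMostOne-move pass one = one
atMostOne-move {p = p} {b = b} (place i count<1 _) _ = atMostOne-at (b [ i ]≔ tok p) i at
  where
  at : ∀ w → lookup (b [ i ]≔ tok p) w ≡ tok p → w ≡ i
  at w own with lookup-update⁻ b i w own
  ... | inj₁ w≡i  = w≡i
  ... | inj₂ own′ = ⊥-elim (<⇒≱ count<1 (tok⇒0<onBoard p b w own′))
atMostOne-move {p = p} {b = b} (shift u i ownᵤ _) one = atMostOne-at ((b [ u ]≔ empty) [ i ]≔ tok p) i at
  where
  at : ∀ w → lookup ((b [ u ]≔ empty) [ i ]≔ tok p) w ≡ tok p → w ≡ i
  at w own with lookup-update⁻ (b [ u ]≔ empty) i w own
  ... | inj₁ w≡i  = w≡i
  ... | inj₂ own′ with one w u (lookup-update-≢ b u w (λ ()) own′) ownᵤ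
  ...   | refl with trans (sym own′) (lookup∘update w b empty)
  ...     | ()

record MakerOccupies (b : Board n) (P : ℕ → Set) : Set where
  constructor occupying
  field owned⇔ : ∀ v → lookup b v ≡ tok maker ⇔ P (toℕ v)

open MakerOccupies

makerOccupies-cong : ∀ {b : Board n} {P Q : ℕ → Set} → (∀ x → P x ⇔ Q x) → MakerOccupies b P → MakerOccupies b Q
makerOccupies-cong P⇔Q occupied = occupying λ v → ⇔-trans (owned⇔ occupied v) (P⇔Q (toℕ v))

makerOccupies-place : ∀ {P : ℕ → Set} (b : Board n) i → MakerOccupies b P →
                      MakerOccupies (b [ i ]≔ tok maker) (λ x → x ≡ toℕ i ⊎ P x)
makerOccupies-place {P = P} b i occupied = occupying λ v → mk⇔ (owned⇒ v) (⇒owned v)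
  where
  owned⇒ : ∀ v → lookup (b [ i ]≔ tok maker) v ≡ tok maker → toℕ v ≡ toℕ i ⊎ P (toℕ v)
  owned⇒ v own = Sum.map (cong toℕ) (to (owned⇔ occupied v)) (lookup-update⁻ b i v own)
  ⇒owned : ∀ v → toℕ v ≡ toℕ i ⊎ P (toℕ v) → lookup (b [ i ]≔ tok maker) v ≡ tok maker
  ⇒owned v (inj₁ v≡i) = lookup-update⁺ b i v λ v≢i → ⊥-elim (v≢i (toℕ-injective v≡i))
  ⇒owned v (inj₂ Pv)  = lookup-update⁺ b i v λ _ → from (owned⇔ occupied v) Pv

makerOccupies-move : ∀ {P} {l} {b b′ : Board n} → Move breaker l b b′ → MakerOccupies b P → MakerOccupies b′ P
makerOccupies-move {b = b} {b′} move occupied = occupying λ v →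
  ⇔-trans (sameTokens-owner {b = b′} {b} (move-sameTokens (λ ()) move) v) (owned⇔ occupied v)

UpToExcept : ℕ → ℕ → ℕ → Set
UpToExcept p h x = x ≤ p × x ≢ h

upToExcept-fill : ∀ {p h} → h ≤ p → ∀ x → (x ≡ h ⊎ UpToExcept p h x) ⇔ UpToExcept (suc p) (suc p) x
upToExcept-fill {p} {h} h≤p x = mk⇔ filled unfilled
  where
  filled : x ≡ h ⊎ UpToExcept p h x → UpToExcept (suc p) (suc p) x
  filled (inj₁ refl)      = m≤n⇒m≤1+n h≤p , <⇒≢ (s≤s h≤p)
  filled (inj₂ (x≤p , _)) = m≤n⇒m≤1+n x≤p , <⇒≢ (s≤s x≤p)
  unfilled : UpToExcept (suc p) (suc p) x → x ≡ h ⊎ UpToExcept p h x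
  unfilled (x≤1+p , x≢1+p) with x ≟ℕ h
  ... | yes x≡h = inj₁ x≡h
  ... | no  x≢h = inj₂ (≤-pred (≤∧≢⇒< x≤1+p x≢1+p) , x≢h)

upToExcept-extend : ∀ {p h} → h ≤ p → ∀ x → (x ≡ suc p ⊎ UpToExcept p h x) ⇔ UpToExcept (suc p) h x
upToExcept-extend {p} {h} h≤p x = mk⇔ extended unextended
  where
  extended : x ≡ suc p ⊎ UpToExcept p h x → UpToExcept (suc p) h x
  extended (inj₁ refl)        = ≤-refl , (λ 1+p≡h → 1+n≰n (subst (_≤ p) (sym 1+p≡h) h≤p))
  extended (inj₂ (x≤p , x≢h)) = m≤n⇒m≤1+n x≤p , x≢h
  unextended : UpToExcept (suc p) h x → x ≡ suc p ⊎ UpToExcept p h x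
  unextended (x≤1+p , x≢h) with x ≟ℕ suc p
  ... | yes x≡1+p = inj₁ x≡1+p
  ... | no  x≢1+p = inj₂ (≤-pred (≤∧≢⇒< x≤1+p x≢1+p) , x≢h)

record Position (p : ℕ) (h : Fin n) (b : Board n) : Set where
  field
    hole≤p     : toℕ h ≤ p
    occupied   : MakerOccupies b (UpToExcept p (toℕ h))
    count      : onBoard maker b ≡ p
    oneBreaker : AtMostOne breaker b

open Position

module _ {p : ℕ} {h : Fin n} {b : Board n} (pos : Position p h b) where

  position-owns : ∀ v → toℕ v ≤ p → v ≢ h → lookup b v ≡ tok maker
  position-owns v v≤p v≢h = from (owned⇔ (occupied pos) v) (v≤p , v≢h ∘ toℕ-injective)

  position-hole : lookup b h ≢ tok maker
  position-hole own = proj₂ (to (owned⇔ (occupied pos) h) own) refl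

  position-free : lookup b h ≡ tok breaker → ∀ v → p < toℕ v → lookup b v ≡ empty
  position-free blocked v p<v = cell-empty (lookup b v) notMaker notBreaker
    where
    notMaker : lookup b v ≢ tok maker
    notMaker own = <⇒≱ p<v (proj₁ (to (owned⇔ (occupied pos) v) own))
    notBreaker : lookup b v ≢ tok breaker
    notBreaker own with oneBreaker pos h v blocked own
    ... | refl = <⇒≱ p<v (hole≤p pos)

  position-fill : lookup b h ≡ empty → ∀ h′ → toℕ h′ ≡ suc p → Position (suc p) h′ (b [ h ]≔ tok maker)
  position-fill free h′ h′≡1+p = record
    { hole≤p     = ≤-reflexive h′≡1+p
    ; occupied   = subst (λ y → MakerOccupies (b [ h ]≔ tok maker) (UpToExcept (suc p) y)) (sym h′≡1+p)
                     (makerOccupies-cong (upToExcept-fill (hole≤p pos)) (makerOccupies-place b h (occupied pos)))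
    ; count      = trans (onBoard-place maker b h free) (cong suc (count pos))
    ; oneBreaker = atMostOne-update b h (λ ()) (oneBreaker pos)
    }

  position-extend : ∀ v → toℕ v ≡ suc p → lookup b v ≡ empty → Position (suc p) h (b [ v ]≔ tok maker)
  position-extend v v≡1+p free = record
    { hole≤p     = m≤n⇒m≤1+n (hole≤p pos)
    ; occupied   = makerOccupies-cong (upToExcept-extend (hole≤p pos))
                     (subst (λ y → MakerOccupies (b [ v ]≔ tok maker) (λ x → x ≡ y ⊎ UpToExcept p (toℕ h) x)) v≡1+p
                       (makerOccupies-place b v (occupied pos)))
    ; count      = trans (onBoard-place maker b v free) (cong suc (count pos))
    ; oneBreaker = atMostOne-update b v (λ ()) (oneBreaker pos)
    }

  position-move : ∀ {b′} → Move breaker 1 b b′ → Position p h b′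
  position-move {b′} move = record
    { hole≤p     = hole≤p pos
    ; occupied   = makerOccupies-move move (occupied pos)
    ; count      = trans (onBoard-cong maker {b′} {b} (move-sameTokens (λ ()) move)) (count pos)
    ; oneBreaker = atMostOne-move move (oneBreaker pos)
    }

position-start : Position 0 zero (emptyBoard {suc n})
position-start {n} = record
  { hole≤p     = z≤n
  ; occupied   = occupying λ v →
                   mk⇔ (λ own → ⊥-elim (noMaker v own)) λ (v≤0 , v≢0) → ⊥-elim (v≢0 (n≤0⇒n≡0 v≤0))
  ; count      = onBoard-emptyBoard {suc n} maker
  ; oneBreaker = atMostOne-emptyBoard breaker
  }
  where
  noMaker : ∀ v → lookup (emptyBoard {suc n}) v ≢ tok maker
  noMaker v own with trans (sym own) (lookup-replicate v empty)
  ... | ()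

HasEdgeWithin : Hypergraph n → (Fin n → Set) → Set
HasEdgeWithin H Q = Any (λ e → ∀ v → lookup e v ≡ true → Q v) (edges H)

completed : ∀ {Q} (H : Hypergraph n) b → HasEdgeWithin H Q → (∀ v → Q v → lookup b v ≡ tok maker) → Completed H b
completed _ _ within owns = Any.map (λ e⊆Q v v∈e → owns v (e⊆Q v v∈e)) within

CountsAtMost : ℕ → List (State n) → Set
CountsAtMost p hist = All (λ state → onBoard maker (proj₂ state) ≤ p) hist

countsAtMost-∉ : ∀ {p q} {hist : List (State n)} {b} → CountsAtMost p hist → onBoard maker b ≡ suc p → (q , b) ∉ hist
countsAtMost-∉ {p = p} counts count≡1+p seen = 1+n≰n (subst (_≤ p) count≡1+p (All.lookup counts seen))

module SequentialStrategy {k : ℕ} (H : Hypergraph (suc (suc k))) (1≤k : 1 ≤ k)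
  (prefixEdge : HasEdgeWithin H (λ v → toℕ v < k))
  (escape : ∀ h → 1 ≤ toℕ h → toℕ h < k →
              ∃[ h′ ] toℕ h′ ≤ k × h′ ≢ h × HasEdgeWithin H (λ v → v ≢ h × v ≢ h′))
  where

  Win : List (State (suc (suc k))) → Board (suc (suc k)) → Set
  Win = MakerWinsFrom H k 1

  Continuation : ℕ → Fin (suc (suc k)) → Set
  Continuation p h = ∀ {hist b} → Position p h b → CountsAtMost p hist → Win hist b

  advance : ∀ {p h hist b s} → Move maker k b s → Position (suc p) h s → CountsAtMost p hist →
            Continuation (suc p) h → Win hist b
  advance {p} {hist = hist} {s = s} move pos counts continue =
    step move (countsAtMost-∉ counts (count pos)) λ reply →
      let pos′ = position-move pos reply in
      unseen (count pos′) ,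
      continue pos′ (≤-reflexive (count pos′) ∷ ≤-reflexive (count pos) ∷ All.map m≤n⇒m≤1+n counts)
    where
    unseen : ∀ {s′} → onBoard maker s′ ≡ suc p → (maker , s′) ∉ (breaker , s) ∷ hist
    unseen _     (here ())
    unseen count (there seen) = countsAtMost-∉ counts count seen

  finish : ∀ {h hist b} → 1 ≤ toℕ h → Position k h b → Win hist b
  finish {h} {hist} {b} 1≤h pos with m≤n⇒m<n∨m≡n (hole≤p pos)
  ... | inj₂ h≡k = win pass (completed H b prefixEdge λ v v<k →
                     position-owns pos v (<⇒≤ v<k) λ v≡h → <⇒≢ v<k (trans (cong toℕ v≡h) h≡k))
  ... | inj₁ h<k = respond (lookup b h) refl
    where
    top : Fin (suc (suc k))
    top = inject₁ (fromℕ k)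
    toℕ-top : toℕ top ≡ k
    toℕ-top = trans (toℕ-inject₁ (fromℕ k)) (toℕ-fromℕ k)
    last : Fin (suc (suc k))
    last = fromℕ (suc k)
    k<last : k < toℕ last
    k<last = subst (k <_) (sym (toℕ-fromℕ (suc k))) ≤-refl
    below-last : ∀ v → v ≢ last → toℕ v ≤ k
    below-last v v≢last = ≤-pred (≤∧≢⇒< (≤-pred (toℕ<n v)) λ v≡1+k →
                            v≢last (toℕ-injective (trans v≡1+k (sym (toℕ-fromℕ (suc k))))))
    respond : ∀ c → lookup b h ≡ c → Win hist b
    respond (tok maker) own = ⊥-elim (position-hole pos own)
    respond empty free =
      win (shift top h (position-owns pos top (≤-reflexive toℕ-top) top≢h) free)
          (completed H ((b [ top ]≔ empty) [ h ]≔ tok maker) prefixEdge λ v v<k →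
             lookup-update₂⁺ b top h v {y = empty} λ v≢h →
             (λ v≡top → <⇒≢ v<k (trans (cong toℕ v≡top) toℕ-top)) , position-owns pos v (<⇒≤ v<k) v≢h)
      where
      top≢h : top ≢ h
      top≢h top≡h = <⇒≢ h<k (trans (cong toℕ (sym top≡h)) toℕ-top)
    respond (tok breaker) blocked with escape h 1≤h h<k
    ... | h′ , h′≤k , h′≢h , edge =
      win (shift h′ last (position-owns pos h′ h′≤k h′≢h) (position-free pos blocked last k<last))
          (completed H ((b [ h′ ]≔ empty) [ last ]≔ tok maker) edge λ v (v≢h , v≢h′) →
             lookup-update₂⁺ b h′ last v {y = empty} λ v≢last →
             v≢h′ , position-owns pos v (below-last v v≢last) v≢h)

  turn : ∀ {p h hist b} → p < k → 1 ≤ toℕ h → Position p h b → CountsAtMost p hist →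
         (∀ {h′} → 1 ≤ toℕ h′ → Continuation (suc p) h′) → Win hist b
  turn {p} {h} {hist} {b} p<k 1≤h pos counts continue = respond (lookup b h) refl
    where
    legal : onBoard maker b < k
    legal = subst (_< k) (sym (count pos)) p<k
    next : Fin (suc (suc k))
    next = fromℕ< (s≤s (s≤s (<⇒≤ p<k)))
    toℕ-next : toℕ next ≡ suc p
    toℕ-next = toℕ-fromℕ< (s≤s (s≤s (<⇒≤ p<k)))
    respond : ∀ c → lookup b h ≡ c → Win hist b
    respond (tok maker) own = ⊥-elim (position-hole pos own)
    respond empty free =
      advance (place h legal free) (position-fill pos free next toℕ-next) counts
              (continue (subst (1 ≤_) (sym toℕ-next) (s≤s z≤n)))
    respond (tok breaker) blocked =
      advance (place next legal nextFree) (position-extend pos next toℕ-next nextFree) counts (continue 1≤h)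
      where
      nextFree : lookup b next ≡ empty
      nextFree = position-free pos blocked next (subst (p <_) (sym toℕ-next) ≤-refl)

  play : ∀ m {p h} → m + p ≡ k → 1 ≤ toℕ h → Continuation p h
  play zero    refl      1≤h pos _      = finish 1≤h pos
  play (suc m) {p} m+p≡k 1≤h pos counts =
    turn (subst (p <_) m+p≡k (s≤s (m≤n+m p m))) 1≤h pos counts (play m (trans (+-suc m p) m+p≡k))

  makerWins : MakerWins H k 1
  makerWins =
    advance (place zero (subst (_< k) (sym (onBoard-emptyBoard {suc (suc k)} maker)) 1≤k) refl)
            (position-fill position-start refl (suc zero) refl)
            (≤-reflexive (onBoard-emptyBoard {suc (suc k)} maker) ∷ [])
            (play (k ∸ 1) (m∸n+n≡m 1≤k) (s≤s z≤n))

pairSet : Fin n → Subset (suc n)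
pairSet i = ⁅ inject₁ i ⁆ ∪ ⁅ suc i ⁆

∣pairSet∣≡2 : ∀ (i : Fin n) → ∣ pairSet i ∣ ≡ 2
∣pairSet∣≡2 {suc n} zero = cong suc (trans (cong ∣_∣ (∪-identityˡ {suc n} ⁅ zero ⁆)) (∣⁅x⁆∣≡1 {suc n} zero))
∣pairSet∣≡2 (suc i)        = ∣pairSet∣≡2 i

∣∁pairSet∣ : ∀ (i : Fin (suc n)) → ∣ ∁ (pairSet i) ∣ ≡ n
∣∁pairSet∣ {n} i = trans (∣∁p∣≡n∸∣p∣ (pairSet i)) (cong (suc (suc n) ∸_) (∣pairSet∣≡2 i))

∈pairSet⇒ : ∀ {i : Fin n} {v} → v ∈ pairSet i → toℕ v ≡ toℕ i ⊎ toℕ v ≡ suc (toℕ i)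
∈pairSet⇒ {i = i} v∈ =
  Sum.map (λ v∈⁅i⁆ → trans (cong toℕ (x∈⁅y⁆⇒x≡y _ v∈⁅i⁆)) (toℕ-inject₁ i)) (cong toℕ ∘ x∈⁅y⁆⇒x≡y _)
          (x∈p∪q⁻ _ _ v∈)

∁pairSet-avoids : ∀ {i : Fin n} v → lookup (∁ (pairSet i)) v ≡ true → v ≢ inject₁ i × v ≢ suc i
∁pairSet-avoids {i = i} v v∈ =
  (λ { refl → v∉ (x∈p∪q⁺ (inj₁ (x∈⁅x⁆ _))) }) , (λ { refl → v∉ (x∈p∪q⁺ (inj₂ (x∈⁅x⁆ _))) })
  where
  v∉ : v ∈ pairSet i → ⊥
  v∉ = x∈∁p⇒x∉p (lookup⇒[]= v _ v∈)

≡⊎≡suc-antisym : ∀ {x y : ℕ} → x ≡ y ⊎ x ≡ suc y → y ≡ x ⊎ y ≡ suc x → x ≡ y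
≡⊎≡suc-antisym           (inj₁ x≡y)  _             = x≡y
≡⊎≡suc-antisym           (inj₂ _)    (inj₁ y≡x)    = sym y≡x
≡⊎≡suc-antisym {y = y}   (inj₂ refl) (inj₂ y≡2+y)  = ⊥-elim (<⇒≢ (m<n⇒m<1+n (n<1+n y)) y≡2+y)

∁pairSet-injective : ∀ {i j : Fin n} → ∁ (pairSet i) ≡ ∁ (pairSet j) → i ≡ j
∁pairSet-injective eq = toℕ-injective (≡⊎≡suc-antisym (start∈ eq) (start∈ (sym eq)))
  where
  start∈ : ∀ {i j : Fin n} → ∁ (pairSet i) ≡ ∁ (pairSet j) → toℕ i ≡ toℕ j ⊎ toℕ i ≡ suc (toℕ j)
  start∈ {i = i} eq = subst (λ x → x ≡ _ ⊎ x ≡ _) (toℕ-inject₁ i) (∈pairSet⇒ (x∉∁p⇒x∈p λ i∈ →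
    x∈p⇒x∉∁p (x∈p∪q⁺ (inj₁ (x∈⁅x⁆ (inject₁ i)))) (subst (inject₁ i ∈_) (sym eq) i∈)))

suc≢inject₁ : ∀ (i : Fin n) → suc i ≢ inject₁ i
suc≢inject₁ i eq = 1+n≢n (trans (cong toℕ eq) (toℕ-inject₁ i))

halve : ∀ t y → y < t * 2 → ∃[ j ] j < t × (y ≡ j * 2 ⊎ y ≡ suc (j * 2))
halve (suc t) zero          _              = 0 , s≤s z≤n , inj₁ refl
halve (suc t) (suc zero)    _              = 0 , s≤s z≤n , inj₂ refl
halve (suc t) (suc (suc y)) (s≤s (s≤s y<)) with halve t y y<
... | j , j<t , inj₁ refl = suc j , s≤s j<t , inj₁ refl
... | j , j<t , inj₂ refl = suc j , s≤s j<t , inj₂ refl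

module PairComplements (k r t : ℕ) (k≡r+2t : k ≡ r + t * 2) where

  pairStart : Fin (suc t) → Fin (suc k)
  pairStart j = fromℕ< (s≤s (≤-trans (+-monoʳ-≤ r (*-monoˡ-≤ 2 (≤-pred (toℕ<n j)))) (≤-reflexive (sym k≡r+2t))))

  toℕ-pairStart : ∀ j → toℕ (pairStart j) ≡ r + toℕ j * 2
  toℕ-pairStart j = toℕ-fromℕ< _

  pairStart-injective : ∀ {i j} → pairStart i ≡ pairStart j → i ≡ j
  pairStart-injective {i} {j} eq = toℕ-injective (*-cancelʳ-≡ (toℕ i) (toℕ j) 2
    (+-cancelˡ-≡ r _ _ (trans (sym (toℕ-pairStart i)) (trans (cong toℕ eq) (toℕ-pairStart j)))))

  suc-pairStart≤k : ∀ {j} → toℕ j < t → toℕ (suc (pairStart j)) ≤ k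
  suc-pairStart≤k {j} j<t = begin
    suc (toℕ (pairStart j)) ≡⟨ cong suc (toℕ-pairStart j) ⟩
    suc (r + toℕ j * 2)     ≡⟨ sym (+-suc r _) ⟩
    r + suc (toℕ j * 2)     ≤⟨ +-monoʳ-≤ r (≤-trans (n≤1+n _) (*-monoˡ-≤ 2 j<t)) ⟩
    r + t * 2               ≡⟨ sym k≡r+2t ⟩
    k                       ∎
    where open ≤-Reasoning

  edge : Fin (suc t) → Subset (suc (suc k))
  edge j = ∁ (pairSet (pairStart j))

  hypergraph : Hypergraph (suc (suc k))
  hypergraph = record
    { edges    = tabulate edge
    ; distinct = Unique.tabulate⁺ (pairStart-injective ∘ ∁pairSet-injective)
    }

  uniform : Uniform k hypergraph
  uniform = All.tabulate⁺ {f = edge} (∣∁pairSet∣ ∘ pairStart)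

  prefixEdge : HasEdgeWithin hypergraph (λ v → toℕ v < k)
  prefixEdge = Any.tabulate⁺ {f = edge} (fromℕ t) below
    where
    last-start : toℕ (pairStart (fromℕ t)) ≡ k
    last-start = trans (toℕ-pairStart (fromℕ t)) (trans (cong (λ x → r + x * 2) (toℕ-fromℕ t)) (sym k≡r+2t))
    below : ∀ v → lookup (edge (fromℕ t)) v ≡ true → toℕ v < k
    below v v∈ = ≤∧≢⇒< (≤-pred (≤∧≢⇒< (≤-pred (toℕ<n v)) v≢1+k)) v≢k
      where
      v≢k : toℕ v ≢ k
      v≢k eq = proj₁ (∁pairSet-avoids v v∈)
                 (toℕ-injective (trans eq (sym (trans (toℕ-inject₁ _) last-start))))
      v≢1+k : toℕ v ≢ suc k
      v≢1+k eq = proj₂ (∁pairSet-avoids v v∈) (toℕ-injective (trans eq (sym (cong suc last-start))))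

  pairOf : ∀ h → r ≤ toℕ h → toℕ h < k →
           ∃[ j ] toℕ j < t × (h ≡ inject₁ (pairStart j) ⊎ h ≡ suc (pairStart j))
  pairOf h r≤h h<k with halve t (toℕ h ∸ r) (+-cancelˡ-< r _ _ (subst₂ _<_ (sym (m+[n∸m]≡n r≤h)) k≡r+2t h<k))
  ... | j , j<t , parity =
    J , subst (_< t) (sym toℕ-J) j<t , Sum.map (toℕ-injective ∘ even) (toℕ-injective ∘ odd) parity
    where
    open ≡-Reasoning
    J : Fin (suc t)
    J = fromℕ< (m<n⇒m<1+n j<t)
    toℕ-J : toℕ J ≡ j
    toℕ-J = toℕ-fromℕ< _
    toℕ-start : toℕ (pairStart J) ≡ r + j * 2
    toℕ-start = trans (toℕ-pairStart J) (cong (λ x → r + x * 2) toℕ-J)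
    even : toℕ h ∸ r ≡ j * 2 → toℕ h ≡ toℕ (inject₁ (pairStart J))
    even eq = begin
      toℕ h                      ≡⟨ sym (m+[n∸m]≡n r≤h) ⟩
      r + (toℕ h ∸ r)            ≡⟨ cong (r +_) eq ⟩
      r + j * 2                  ≡⟨ sym toℕ-start ⟩
      toℕ (pairStart J)          ≡⟨ sym (toℕ-inject₁ _) ⟩
      toℕ (inject₁ (pairStart J)) ∎
    odd : toℕ h ∸ r ≡ suc (j * 2) → toℕ h ≡ toℕ (suc (pairStart J))
    odd eq = begin
      toℕ h                      ≡⟨ sym (m+[n∸m]≡n r≤h) ⟩
      r + (toℕ h ∸ r)            ≡⟨ cong (r +_) eq ⟩
      r + suc (j * 2)            ≡⟨ +-suc r _ ⟩
      suc (r + j * 2)            ≡⟨ cong suc (sym toℕ-start) ⟩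
      toℕ (suc (pairStart J))    ∎

  escape : ∀ h → r ≤ toℕ h → toℕ h < k →
           ∃[ h′ ] toℕ h′ ≤ k × h′ ≢ h × HasEdgeWithin hypergraph (λ v → v ≢ h × v ≢ h′)
  escape h r≤h h<k with pairOf h r≤h h<k
  ... | j , j<t , inj₁ refl =
    suc (pairStart j) , suc-pairStart≤k j<t , suc≢inject₁ _ , Any.tabulate⁺ {f = edge} j ∁pairSet-avoids
  ... | j , j<t , inj₂ refl =
    inject₁ (pairStart j) ,
    ≤-trans (≤-reflexive (toℕ-inject₁ _)) (≤-trans (n≤1+n _) (suc-pairStart≤k j<t)) ,
    suc≢inject₁ _ ∘ sym ,
    Any.tabulate⁺ {f = edge} j (λ v → swap ∘ ∁pairSet-avoids v)

proposition3p5 : (k : ℕ) → 1 ≤ k →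
    Σ ℕ (λ n → Σ (Hypergraph n) (λ H →
    Uniform k H × numEdges H ≡ k / 2 + 1 × MakerWins H k 1))
proposition3p5 k 1≤k = suc (suc k) , hypergraph , uniform , edgeCount , makerWins
  where
  open PairComplements k (k % 2) (k / 2) (m≡m%n+[m/n]*n k 2)
  r≤1 : k % 2 ≤ 1
  r≤1 = ≤-pred (m%n<n k 2)
  edgeCount : numEdges hypergraph ≡ k / 2 + 1
  edgeCount = trans (length-tabulate edge) (+-comm 1 (k / 2))
  open SequentialStrategy hypergraph 1≤k prefixEdge (λ h 1≤h → escape h (≤-trans r≤1 1≤h))
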